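{- Let $\Gamma$ be a graph and let $\Gamma_0$ be the pure graph with the same underlying graph as $\Gamma$ (all weights set to $0$). Then $\mathbf{QD}(\Gamma)$ is isomorphic to $\mathbf{QD}(\Gamma_0)$.
   Context: Graphs are finite, loops and multiple edges allowed, with weights $w\colon V(\Gamma)\to\mathbb Z_{\ge0}$ and genus $g=b_1(\Gamma)+\sum w(v)$; $\mathrm{val}(v)$ counts loops twice. For $\mathcal E\subset E(\Gamma)$, $\Gamma^{\mathcal E}$ is obtained by inserting one vertex $v_e$ in each $e\in\mathcal E$. A pseudo-divisor is $(\mathcal E,D)$ with $D\colon V(\Gamma^{\mathcal E})\to\mathbb Z$, $D(v_e)=1$ for $e\in\mathcal E$. Order: $(\mathcal E,D)\ge(\mathcal E',D')$ iff $\mathcal E'\subset\mathcal E$ and there is $\varphi\colon\mathcal E\setminus\mathcal E'\to V(\Gamma)$, $\varphi(e)$ an end-vertex of $e$, with $D'(v)=D(v)+|\varphi^{ -1}(v)|$ for $v\in V(\Gamma)$. Canonical polarization $\mu(v)=w(v)-1+\mathrm{val}(v)/2$ on $V(\Gamma)$, $0$ on exceptional vertices; $(\mathcal E,D)$ of degree $g-1$ is $v_0$-quasistable if $D(V)-\mu(V)+\delta_V/2\ge0$ for all nonempty $V\subset V(\Gamma^{\mathcal E})$, strictly when $v_0\notin V$ ($\delta_V$ = number of edges of $\Gamma^{\mathcal E}$ between $V$ and its complement). $\mathbf{QD}(\Gamma)$ denotes the poset $\mathbf{QD}_{v_0}(\Gamma)$ of $v_0$-quasistable pseudo-divisors for any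 vertex $v_0$ (independent of $v_0$ up to isomorphism). -}

module Defs where

open import Data.Nat as ℕ using (ℕ; zero; suc; _<ᵇ_)
open import Data.Integer as ℤ using (ℤ; +_; _+_; _-_; _*_; _≤_; _<_)
open import Data.Fin using (Fin; zero; suc; toℕ; _≟_)
open import Data.Bool using (Bool; true; false; _∧_; _∨_; not; _xor_; if_then_else_)
open import Data.Vec using (Vec; lookup)
open import Data.Product using (Σ; _×_; _,_; proj₁)
open import Data.Sum using (_⊎_)
open import Relation.Binary.PropositionalEquality using (_≡_)
open import Relation.Nullary.Decidable using (⌊_⌋)

sumℤ : ∀ {k} → (Fin k → ℤ) → ℤ
sumℤ {zero}  f = + 0
sumℤ {suc k} f = f zero + sumℤ (λ i → f (suc i))

count : ∀ {k} → (Fin k → Bool) → ℕ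
count {zero}  f = 0
count {suc k} f = (if f zero then 1 else 0) ℕ.+ count (λ i → f (suc i))

anyF : ∀ {k} → (Fin k → Bool) → Bool
anyF {zero}  f = false
anyF {suc k} f = f zero ∨ anyF (λ i → f (suc i))

[_] : Bool → ℤ
[ true ]  = + 1
[ false ] = + 0

_==_ : ∀ {k} → Fin k → Fin k → Bool
u == v = ⌊ u ≟ v ⌋

-- Weighted graphs: vertices Fin nV, edges Fin nE, each edge e has end
-- vertices src e and tgt e (loops: src e ≡ tgt e; multiple edges allowed).

record Graph : Set where
  field
    nV  : ℕ
    nE  : ℕ
    src : Fin nE → Fin nV
    tgt : Fin nE → Fin nV
    w   : Fin nV → ℕ

pure : Graph → Graph
pure Γ = record Γ { w = λ _ → 0 }

module _ (Γ : Graph) where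
  open Graph Γ

  -- valence (loops counted twice)
  val : Fin nV → ℤ
  val v = sumℤ (λ e → [ src e == v ] + [ tgt e == v ])

  reach : ℕ → Fin nV → Fin nV → Bool
  reach zero    u v = u == v
  reach (suc k) u v = reach k u v ∨
    anyF (λ e → (reach k u (src e) ∧ (tgt e == v)) ∨ (reach k u (tgt e) ∧ (src e == v)))

  -- number of connected components: vertices that are the least vertex
  -- of their component
  numComponents : ℕ
  numComponents = count (λ v → not (anyF (λ u → (toℕ u <ᵇ toℕ v) ∧ reach nV v u)))

  b1 : ℤ
  b1 = (+ nE - + nV) + + numComponents

  genus : ℤ
  genus = b1 + sumℤ (λ v → + w v)

  -- twice the canonical polarization μ(v) = w(v) - 1 + val(v)/2
  twiceμ : Fin nV → ℤ
  twiceμ v = (+ 2 * + w v - + 2) + val v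

  -- Pseudo-divisor (ℰ , D): ℰ ⊆ E(Γ) as a Boolean vector, D on V(Γ);
  -- D(v_e) = 1 on the exceptional vertices is implicit.
  PD : Set
  PD = Vec Bool nE × Vec ℤ nV

  deg : PD → ℤ
  deg (ℰ , D) = sumℤ (lookup D) + sumℤ (λ e → [ lookup ℰ e ])

  -- A subset V of V(Γ^ℰ) is given by S ⊆ V(Γ) and T ⊆ ℰ (exceptional
  -- vertices v_e, e ∈ ℰ).  δ_V = number of edges of Γ^ℰ crossing V.
  δ : PD → (Fin nV → Bool) → (Fin nE → Bool) → ℤ
  δ (ℰ , D) S T = sumℤ (λ e →
    if lookup ℰ e
    then [ S (src e) xor T e ] + [ T e xor S (tgt e) ]
    else [ S (src e) xor S (tgt e) ])

  -- 2 (D(V) - μ(V) + δ_V / 2)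
  twiceQS : PD → (Fin nV → Bool) → (Fin nE → Bool) → ℤ
  twiceQS (ℰ , D) S T =
    (+ 2 * (sumℤ (λ v → if S v then lookup D v else + 0) + sumℤ (λ e → [ T e ]))
      - sumℤ (λ v → if S v then twiceμ v else + 0))
    + δ (ℰ , D) S T

  QuasiStable : Fin nV → PD → Set
  QuasiStable v0 (ℰ , D) =
    deg (ℰ , D) ≡ genus - + 1 ×
    ((S : Fin nV → Bool) (T : Fin nE → Bool) →
      (∀ e → T e ≡ true → lookup ℰ e ≡ true) →
      (anyF S ∨ anyF T) ≡ true →
      (S v0 ≡ true → + 0 ≤ twiceQS (ℰ , D) S T) ×
      (S v0 ≡ false → + 0 < twiceQS (ℰ , D) S T))

  _≥PD_ : PD → PD → Set
  (ℰ , D) ≥PD (ℰ' , D') =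
    (∀ e → lookup ℰ' e ≡ true → lookup ℰ e ≡ true) ×
    Σ (Fin nE → Fin nV) (λ φ →
      (∀ e → lookup ℰ e ≡ true → lookup ℰ' e ≡ false → (φ e ≡ src e ⊎ φ e ≡ tgt e)) ×
      (∀ v → lookup D' v ≡ lookup D v +
          + count (λ e → lookup ℰ e ∧ not (lookup ℰ' e) ∧ (φ e == v))))

  QD : Fin nV → Set
  QD v0 = Σ PD (QuasiStable v0)

-- Isomorphism of posets given as subtypes of carriers A, B with orders.
-- Elements are compared via their underlying pseudo-divisors.

record PosetIso {A B : Set} (P : A → Set) (Q : B → Set)
                (_≥A_ : A → A → Set) (_≥B_ : B → B → Set) : Set where
  field
    to      : Σ A P → Σ B Q
    from    : Σ B Q → Σ A P
    from∘to : ∀ x → proj₁ (from (to x)) ≡ proj₁ x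
    to∘from : ∀ y → proj₁ (to (from y)) ≡ proj₁ y
    to-mono   : ∀ x y → proj₁ x ≥A proj₁ y → proj₁ (to x) ≥B proj₁ (to y)
    to-reflect : ∀ x y → proj₁ (to x) ≥B proj₁ (to y) → proj₁ x ≥A proj₁ y

QDIso : (Γ Γ' : Graph) → Fin (Graph.nV Γ) → Fin (Graph.nV Γ') → Set
QDIso Γ Γ' v0 v0' = PosetIso (QuasiStable Γ v0) (QuasiStable Γ' v0') (_≥PD_ Γ) (_≥PD_ Γ')

{-# OPTIONS --safe #-}
module Submission where

-- Changing the vertex weights of Γ from w to w′ raises the genus by Σ (w′ − w) and
-- twice the canonical polarization at v by 2 (w′ v − w v), while the edges, hence the
-- valences, the Betti number and all the δ_V, stay the same.  So translating the
-- divisor part of a pseudo-divisor by w′ − w preserves both the degree condition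
-- deg = g − 1 and every quasistability inequality, and it visibly preserves the
-- specialization order; translating back by w − w′ is its inverse.

open import Defs
open import Data.Bool using (Bool; true; false; if_then_else_; not; _∧_; _∨_)
open import Data.Fin using (Fin; zero; suc; toℕ)
open import Data.Nat as ℕ using (ℕ; _<ᵇ_)
open import Data.Integer using (ℤ; +_; _+_; _-_; _*_; _≤_; _<_)
open import Data.Integer.Tactic.RingSolver using (solve-∀)
open import Data.Product using (_×_; _,_)
open import Data.Vec using (Vec; lookup; tabulate)
open import Data.Vec.Properties using (lookup∘tabulate; tabulate∘lookup; tabulate-cong)
open import Function using (_∘_)
open import Relation.Binary.PropositionalEquality
  using (_≡_; refl; sym; trans; cong; cong₂; subst; subst₂; module ≡-Reasoning)

open ≡-Reasoning

sumℤ-cong : ∀ {k} {f g : Fin k → ℤ} → (∀ i → f i ≡ g i) → sumℤ f ≡ sumℤ g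
sumℤ-cong {ℕ.zero}  f≗g = refl
sumℤ-cong {ℕ.suc k} f≗g = cong₂ _+_ (f≗g zero) (sumℤ-cong (λ i → f≗g (suc i)))

anyF-cong : ∀ {k} {f g : Fin k → Bool} → (∀ i → f i ≡ g i) → anyF f ≡ anyF g
anyF-cong {ℕ.zero}  f≗g = refl
anyF-cong {ℕ.suc k} f≗g = cong₂ _∨_ (f≗g zero) (anyF-cong (λ i → f≗g (suc i)))

count-cong : ∀ {k} {f g : Fin k → Bool} → (∀ i → f i ≡ g i) → count f ≡ count g
count-cong {ℕ.zero}  f≗g = refl
count-cong {ℕ.suc k} f≗g =
  cong₂ (λ b n → (if b then 1 else 0) ℕ.+ n) (f≗g zero) (count-cong (λ i → f≗g (suc i)))

sumℤ-distrib-+ : ∀ {k} (f g : Fin k → ℤ) → sumℤ (λ i → f i + g i) ≡ sumℤ f + sumℤ g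
sumℤ-distrib-+ {ℕ.zero}  f g = refl
sumℤ-distrib-+ {ℕ.suc k} f g = begin
  (f zero + g zero) + sumℤ (λ i → f (suc i) + g (suc i))
    ≡⟨ cong (_+_ (f zero + g zero)) (sumℤ-distrib-+ (λ i → f (suc i)) (λ i → g (suc i))) ⟩
  (f zero + g zero) + (sumℤ (λ i → f (suc i)) + sumℤ (λ i → g (suc i)))
    ≡⟨ interchange (f zero) (g zero) (sumℤ (λ i → f (suc i))) (sumℤ (λ i → g (suc i))) ⟩
  (f zero + sumℤ (λ i → f (suc i))) + (g zero + sumℤ (λ i → g (suc i))) ∎
  where
  interchange : ∀ a b c d → (a + b) + (c + d) ≡ (a + c) + (b + d)
  interchange = solve-∀

sumℤ-distribˡ-* : ∀ {k} (c : ℤ) (f : Fin k → ℤ) → sumℤ (λ i → c * f i) ≡ c * sumℤ f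
sumℤ-distribˡ-* {ℕ.zero}  c f = zeroʳ c
  where
  zeroʳ : ∀ c → + 0 ≡ c * + 0
  zeroʳ = solve-∀
sumℤ-distribˡ-* {ℕ.suc k} c f = begin
  c * f zero + sumℤ (λ i → c * f (suc i))
    ≡⟨ cong (_+_ (c * f zero)) (sumℤ-distribˡ-* c (λ i → f (suc i))) ⟩
  c * f zero + c * sumℤ (λ i → f (suc i))
    ≡⟨ distribˡ c (f zero) _ ⟩
  c * (f zero + sumℤ (λ i → f (suc i))) ∎
  where
  distribˡ : ∀ c a b → c * a + c * b ≡ c * (a + b)
  distribˡ = solve-∀

sumOn : ∀ {k} → (Fin k → Bool) → (Fin k → ℤ) → ℤ
sumOn S f = sumℤ (λ i → if S i then f i else + 0)

sumOn-cong : ∀ {k} (S : Fin k → Bool) {f g : Fin k → ℤ} → (∀ i → f i ≡ g i) →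
             sumOn S f ≡ sumOn S g
sumOn-cong S f≗g = sumℤ-cong (λ i → cong (if S i then_else + 0) (f≗g i))

sumOn-distrib-+ : ∀ {k} (S : Fin k → Bool) (f g : Fin k → ℤ) →
                  sumOn S (λ i → f i + g i) ≡ sumOn S f + sumOn S g
sumOn-distrib-+ S f g = trans (sumℤ-cong if-distrib)
  (sumℤ-distrib-+ (λ i → if S i then f i else + 0) (λ i → if S i then g i else + 0))
  where
  if-distrib : ∀ i → (if S i then f i + g i else + 0) ≡
                     (if S i then f i else + 0) + (if S i then g i else + 0)
  if-distrib i with S i
  ... | true  = refl
  ... | false = refl

sumOn-distribˡ-* : ∀ {k} (S : Fin k → Bool) (c : ℤ) (f : Fin k → ℤ) →
                   sumOn S (λ i → c * f i) ≡ c * sumOn S f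
sumOn-distribˡ-* S c f =
  trans (sumℤ-cong if-distrib) (sumℤ-distribˡ-* c (λ i → if S i then f i else + 0))
  where
  zeroʳ : ∀ c → + 0 ≡ c * + 0
  zeroʳ = solve-∀
  if-distrib : ∀ i → (if S i then c * f i else + 0) ≡ c * (if S i then f i else + 0)
  if-distrib i with S i
  ... | true  = refl
  ... | false = zeroʳ c

translate : ∀ {m n} → (Fin n → ℤ) → Vec Bool m × Vec ℤ n → Vec Bool m × Vec ℤ n
translate c (ℰ , D) = ℰ , tabulate (λ v → lookup D v + c v)

translate-inverse : ∀ {m n} {c d : Fin n → ℤ} → (∀ v → c v + d v ≡ + 0) →
                    (x : Vec Bool m × Vec ℤ n) → translate d (translate c x) ≡ x
translate-inverse {c = c} {d} c+d≡0 (ℰ , D) =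
  cong (ℰ ,_) (trans (tabulate-cong cancel) (tabulate∘lookup D))
  where
  reassoc : ∀ a b e → (a + b) + e ≡ a + (b + e)
  reassoc = solve-∀
  identityʳ : ∀ a → a + + 0 ≡ a
  identityʳ = solve-∀
  cancel : ∀ v → lookup (tabulate (λ u → lookup D u + c u)) v + d v ≡ lookup D v
  cancel v = begin
    lookup (tabulate (λ u → lookup D u + c u)) v + d v
      ≡⟨ cong (_+ d v) (lookup∘tabulate _ v) ⟩
    (lookup D v + c v) + d v      ≡⟨ reassoc (lookup D v) (c v) (d v) ⟩
    lookup D v + (c v + d v)      ≡⟨ cong (_+_ (lookup D v)) (c+d≡0 v) ⟩
    lookup D v + + 0              ≡⟨ identityʳ _ ⟩
    lookup D v                    ∎

module _ (Γ : Graph) where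
  open Graph Γ

  deg-translate : (c : Fin nV → ℤ) (x : PD Γ) → deg Γ (translate c x) ≡ deg Γ x + sumℤ c
  deg-translate c (ℰ , D) = begin
    sumℤ (lookup (tabulate (λ v → lookup D v + c v))) + t
      ≡⟨ cong (_+ t) (sumℤ-cong (lookup∘tabulate (λ v → lookup D v + c v))) ⟩
    sumℤ (λ v → lookup D v + c v) + t
      ≡⟨ cong (_+ t) (sumℤ-distrib-+ (lookup D) c) ⟩
    (sumℤ (lookup D) + sumℤ c) + t
      ≡⟨ swap (sumℤ (lookup D)) (sumℤ c) t ⟩
    (sumℤ (lookup D) + t) + sumℤ c ∎
    where
    t = sumℤ (λ e → [ lookup ℰ e ])
    swap : ∀ a b e → (a + b) + e ≡ (a + e) + b
    swap = solve-∀

  twiceQS-translate : (c : Fin nV → ℤ) (x : PD Γ) (S : Fin nV → Bool) (T : Fin nE → Bool) →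
    twiceQS Γ (translate c x) S T ≡ twiceQS Γ x S T + + 2 * sumOn S c
  twiceQS-translate c (ℰ , D) S T = begin
    (+ 2 * (sumOn S (lookup (tabulate (λ v → lookup D v + c v))) + t) - M) + δ₀
      ≡⟨ cong (λ a → (+ 2 * (a + t) - M) + δ₀) translated ⟩
    (+ 2 * ((sumOn S (lookup D) + sumOn S c) + t) - M) + δ₀
      ≡⟨ rearrange (sumOn S (lookup D)) (sumOn S c) t M δ₀ ⟩
    (+ 2 * (sumOn S (lookup D) + t) - M) + δ₀ + + 2 * sumOn S c ∎
    where
    t  = sumℤ (λ e → [ T e ])
    M  = sumOn S (twiceμ Γ)
    δ₀ = δ Γ (ℰ , D) S T
    translated : sumOn S (lookup (tabulate (λ v → lookup D v + c v))) ≡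
                 sumOn S (lookup D) + sumOn S c
    translated = trans (sumOn-cong S (lookup∘tabulate (λ v → lookup D v + c v)))
                       (sumOn-distrib-+ S (lookup D) c)
    rearrange : ∀ a s t m d → (+ 2 * ((a + s) + t) - m) + d ≡ (+ 2 * (a + t) - m) + d + + 2 * s
    rearrange = solve-∀

  translate-mono : (c : Fin nV → ℤ) {x y : PD Γ} →
                   _≥PD_ Γ x y → _≥PD_ Γ (translate c x) (translate c y)
  translate-mono c {ℰ₁ , D₁} {ℰ₂ , D₂} (ℰ₂⊆ℰ₁ , φ , φ-incident , D₂≡D₁+φ) =
    ℰ₂⊆ℰ₁ , φ , φ-incident , λ v → begin
      lookup (tabulate (λ u → lookup D₂ u + c u)) v   ≡⟨ lookup∘tabulate _ v ⟩
      lookup D₂ v + c v                               ≡⟨ cong (_+ c v) (D₂≡D₁+φ v) ⟩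
      (lookup D₁ v + n v) + c v                       ≡⟨ swap (lookup D₁ v) (n v) (c v) ⟩
      (lookup D₁ v + c v) + n v
        ≡⟨ cong (_+ n v) (sym (lookup∘tabulate (λ u → lookup D₁ u + c u) v)) ⟩
      lookup (tabulate (λ u → lookup D₁ u + c u)) v + n v ∎
    where
    n : Fin nV → ℤ
    n v = + count (λ e → lookup ℰ₁ e ∧ not (lookup ℰ₂ e) ∧ (φ e == v))
    swap : ∀ a b e → (a + b) + e ≡ (a + e) + b
    swap = solve-∀

reweight : (Γ : Graph) → (Fin (Graph.nV Γ) → ℕ) → Graph
reweight Γ w′ = record Γ { w = w′ }

module _ (Γ : Graph) (w′ : Fin (Graph.nV Γ) → ℕ) where
  open Graph Γ

  weightShift : Fin nV → ℤ
  weightShift v = + w′ v - + w v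

  reach-reweight : ∀ k u v → reach (reweight Γ w′) k u v ≡ reach Γ k u v
  reach-reweight ℕ.zero    u v = refl
  reach-reweight (ℕ.suc k) u v = cong₂ _∨_ (reach-reweight k u v) (anyF-cong step)
    where
    step : ∀ e → (reach (reweight Γ w′) k u (src e) ∧ (tgt e == v)) ∨
                 (reach (reweight Γ w′) k u (tgt e) ∧ (src e == v))
               ≡ (reach Γ k u (src e) ∧ (tgt e == v)) ∨ (reach Γ k u (tgt e) ∧ (src e == v))
    step e = cong₂ _∨_ (cong (_∧ (tgt e == v)) (reach-reweight k u (src e)))
                       (cong (_∧ (src e == v)) (reach-reweight k u (tgt e)))

  genus-reweight : genus (reweight Γ w′) ≡ genus Γ + sumℤ weightShift
  genus-reweight = begin
    b1′ + sumℤ (λ v → + w′ v)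
      ≡⟨ cong₂ _+_ b1-reweight (sumℤ-cong w′≡w+shift) ⟩
    b1 Γ + sumℤ (λ v → + w v + weightShift v)
      ≡⟨ cong (_+_ (b1 Γ)) (sumℤ-distrib-+ (λ v → + w v) weightShift) ⟩
    b1 Γ + (sumℤ (λ v → + w v) + sumℤ weightShift)
      ≡⟨ assoc (b1 Γ) (sumℤ (λ v → + w v)) (sumℤ weightShift) ⟩
    genus Γ + sumℤ weightShift ∎
    where
    b1′ = b1 (reweight Γ w′)
    b1-reweight : b1′ ≡ b1 Γ
    b1-reweight = cong (λ n → (+ nE - + nV) + + n) (count-cong (λ v → cong not
      (anyF-cong (λ u → cong ((toℕ u <ᵇ toℕ v) ∧_) (reach-reweight nV v u)))))
    w′≡w+shift : ∀ v → + w′ v ≡ + w v + weightShift v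
    w′≡w+shift v = split (+ w′ v) (+ w v)
      where
      split : ∀ a b → a ≡ b + (a - b)
      split = solve-∀
    assoc : ∀ a b c → a + (b + c) ≡ (a + b) + c
    assoc = solve-∀

  twiceQS-reweight : (x : PD Γ) (S : Fin nV → Bool) (T : Fin nE → Bool) →
    twiceQS Γ x S T ≡ twiceQS (reweight Γ w′) x S T + + 2 * sumOn S weightShift
  twiceQS-reweight (ℰ , D) S T = begin
    (+ 2 * (A + t) - M) + δ₀
      ≡⟨ rearrange (A + t) M δ₀ (sumOn S weightShift) ⟩
    (+ 2 * (A + t) - (M + + 2 * sumOn S weightShift)) + δ₀ + + 2 * sumOn S weightShift
      ≡⟨ cong (λ m → (+ 2 * (A + t) - m) + δ₀ + + 2 * sumOn S weightShift) (sym M′≡M+shift) ⟩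
    (+ 2 * (A + t) - M′) + δ₀ + + 2 * sumOn S weightShift ∎
    where
    A  = sumOn S (lookup D)
    t  = sumℤ (λ e → [ T e ])
    M  = sumOn S (twiceμ Γ)
    M′ = sumOn S (twiceμ (reweight Γ w′))
    δ₀ = δ Γ (ℰ , D) S T
    shift-μ : ∀ a b e → (+ 2 * a - + 2) + e ≡ ((+ 2 * b - + 2) + e) + + 2 * (a - b)
    shift-μ = solve-∀
    M′≡M+shift : M′ ≡ M + + 2 * sumOn S weightShift
    M′≡M+shift = begin
      M′
        ≡⟨ sumOn-cong S (λ v → shift-μ (+ w′ v) (+ w v) (val Γ v)) ⟩
      sumOn S (λ v → twiceμ Γ v + + 2 * weightShift v)
        ≡⟨ sumOn-distrib-+ S (twiceμ Γ) (λ v → + 2 * weightShift v) ⟩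
      M + sumOn S (λ v → + 2 * weightShift v)
        ≡⟨ cong (_+_ M) (sumOn-distribˡ-* S (+ 2) weightShift) ⟩
      M + + 2 * sumOn S weightShift ∎
    rearrange : ∀ a m d s → (+ 2 * a - m) + d ≡ (+ 2 * a - (m + + 2 * s)) + d + + 2 * s
    rearrange = solve-∀

  quasiStable-reweight : ∀ {v0} (x : PD Γ) →
    QuasiStable Γ v0 x → QuasiStable (reweight Γ w′) v0 (translate weightShift x)
  quasiStable-reweight (ℰ , D) (deg≡g-1 , stable) = degree , λ S T T⊆ℰ nonempty →
    let (semistable , strict) = stable S T T⊆ℰ nonempty
    in  subst (+ 0 ≤_) (twiceQS-invariant S T) ∘ semistable ,
        subst (+ 0 <_) (twiceQS-invariant S T) ∘ strict
    where
    Γ′ = reweight Γ w′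
    degree : deg Γ′ (translate weightShift (ℰ , D)) ≡ genus Γ′ - + 1
    degree = begin
      deg Γ′ (translate weightShift (ℰ , D))  ≡⟨ deg-translate Γ′ weightShift (ℰ , D) ⟩
      deg Γ (ℰ , D) + sumℤ weightShift       ≡⟨ cong (_+ sumℤ weightShift) deg≡g-1 ⟩
      (genus Γ - + 1) + sumℤ weightShift     ≡⟨ swap (genus Γ) (sumℤ weightShift) ⟩
      (genus Γ + sumℤ weightShift) - + 1     ≡⟨ cong (_- + 1) (sym genus-reweight) ⟩
      genus Γ′ - + 1                          ∎
      where
      swap : ∀ g s → (g - + 1) + s ≡ (g + s) - + 1
      swap = solve-∀
    twiceQS-invariant : ∀ S T →
      twiceQS Γ (ℰ , D) S T ≡ twiceQS Γ′ (translate weightShift (ℰ , D)) S T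
    twiceQS-invariant S T =
      trans (twiceQS-reweight (ℰ , D) S T) (sym (twiceQS-translate Γ′ weightShift (ℰ , D) S T))

reweight-iso : (Γ : Graph) (w′ : Fin (Graph.nV Γ) → ℕ) (v0 : Fin (Graph.nV Γ)) →
               QDIso Γ (reweight Γ w′) v0 v0
reweight-iso Γ w′ v0 = record
  { to         = λ (x , qs) → translate shift x , quasiStable-reweight Γ w′ x qs
  ; from       = λ (y , qs) → translate unshift y , quasiStable-reweight Γ′ (Graph.w Γ) y qs
  ; from∘to    = λ (x , _) → translate-inverse shift+unshift≡0 x
  ; to∘from    = λ (y , _) → translate-inverse unshift+shift≡0 y
  ; to-mono    = λ (x , _) (y , _) → translate-mono Γ shift {x} {y}
  ; to-reflect = λ (x , _) (y , _) tx≥ty →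
      subst₂ (_≥PD_ Γ) (translate-inverse shift+unshift≡0 x)
                       (translate-inverse shift+unshift≡0 y)
             (translate-mono Γ unshift {translate shift x} {translate shift y} tx≥ty)
  }
  where
  -- reweight Γ′ (Graph.w Γ) is Γ itself up to record η, so `from` is `to` run backwards.
  Γ′ = reweight Γ w′
  shift unshift : Fin (Graph.nV Γ) → ℤ
  shift   = weightShift Γ w′
  unshift = weightShift Γ′ (Graph.w Γ)
  opposite : ∀ a b → (a - b) + (b - a) ≡ + 0
  opposite = solve-∀
  shift+unshift≡0 : ∀ v → shift v + unshift v ≡ + 0
  shift+unshift≡0 v = opposite (+ w′ v) (+ Graph.w Γ v)
  unshift+shift≡0 : ∀ v → unshift v + shift v ≡ + 0
  unshift+shift≡0 v = opposite (+ Graph.w Γ v) (+ w′ v)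

proposition5p3 : (Γ : Graph) (v0 : Fin (Graph.nV Γ)) → QDIso Γ (pure Γ) v0 v0
proposition5p3 Γ = reweight-iso Γ (λ _ → 0)
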